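{- Let $K_1$ and $K_2$ be finite simple undirected graphs with disjoint vertex sets (and, as in the paper, nonempty), and let $G=K_1\ast K_2$ be their join: $V(G)=V(K_1)\cup V(K_2)$ and $E(G)$ consists of $E(K_1)$, $E(K_2)$, and all edges $\{p,q\}$ with $p\in V(K_1)$, $q\in V(K_2)$. Then $\mathcal{H}^{\mathrm{Path}}_n(K_1\ast K_2)\cong\mathcal{H}^{\mathrm{Cube}}_n(K_1\ast K_2)\cong(0)$ for all $n>0$.
   Context: $R$ is a commutative ring with unit; graphs are finite, simple and undirected. A graph homomorphism is a vertex map sending adjacent vertices to equal or adjacent vertices. $Q_n$ is the graph on $\{0,1\}^n$ with edges between vertices at Hamming distance one ($Q_0$ a single vertex). Discrete cubical homology $\mathcal{H}^{\mathrm{Cube}}_\bullet(G)$: a singular $n$-cube is a graph homomorphism $\sigma: Q_n\to G$; $\mathcal{L}^{\mathrm{Cube}}_n(G)$ is the free $R$-module on them. For $n\ge1$, $i\in[n]$: $f_i^{\pm}\sigma(a_1,\dots,a_{n-1})=\sigma(a_1,\dots,a_{i-1},\epsilon,a_i,\dots,a_{n-1})$ with $\epsilon=1$ for $+$, $\epsilon=0$ for $-$. $\sigma$ is degenerate if $f_i^+\sigma=f_i^-\sigma$ for some $i$. $\mathcal{C}^{\mathrm{Cube}}_n(G)$ is $\mathcal{L}^{\mathrm{Cube}}_n(G)$ modulo degenerate cubes, with $\partial_n\sigma=\sum_{i=1}^n(-1)^i(f_i^-\sigma-f_i^+\sigma)$, $\partial_0=0$; $\mathcal{H}^{\mathrm{Cube}}_n(G)$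 is its homology. Path homology $\mathcal{H}^{\mathrm{Path}}_\bullet(G)$: $\mathcal{C}_n(V)$ is the free $R$-module on $(n+1)$-tuples of vertices modulo tuples with $v_i=v_{i+1}$ for some $i$, with $\partial_n(v_0,\dots,v_n)=\sum_{i=0}^n(-1)^i(v_0,\dots,\widehat{v_i},\dots,v_n)$, $\partial_0=0$. $\widetilde{\mathcal{C}}_n(G)\subseteq\mathcal{C}_n(V)$ is generated by allowed paths (tuples with $\{v_i,v_{i+1}\}\in E(G)$ for all $i$), $\widetilde{\mathcal{C}}_{ -1}=0$; $\mathcal{C}^{\mathrm{Path}}_n(G)=\{x\in\widetilde{\mathcal{C}}_n(G):\partial_nx\in\widetilde{\mathcal{C}}_{n-1}(G)\}$ and $\mathcal{H}^{\mathrm{Path}}_n(G)$ is its homology. -}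

module Defs where

open import Level using (Level)
open import Algebra.Bundles using (CommutativeRing)
open import Data.Bool using (Bool; true; false; if_then_else_; _∧_)
open import Data.Nat using (ℕ; zero; suc; _≤_)
import Data.Nat as ℕ
open import Data.Fin using (Fin; toℕ; splitAt)
import Data.Fin as Fin
open import Data.Vec using (Vec; []; _∷_; insertAt; removeAt; updateAt)
import Data.Vec.Properties as VecP
open import Data.List using (List; []; _∷_; _++_; map; concatMap; foldr; allFin)
open import Data.Product using (Σ; _×_; _,_; ∃)
open import Data.Sum using (_⊎_; inj₁; inj₂)
open import Data.Unit using (⊤)
open import Data.Empty using (⊥)
open import Relation.Nullary using (¬_)
open import Relation.Nullary.Decidable using (⌊_⌋)
open import Relation.Binary.PropositionalEquality using (_≡_)

record Graph : Set₁ where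
  field
    size   : ℕ
    Adj    : Fin size → Fin size → Set
    sym    : ∀ {x y} → Adj x y → Adj y x
    irrefl : ∀ {x} → ¬ Adj x x

open Graph public

NonEmptyGraph : Graph → Set
NonEmptyGraph K = 1 ≤ size K

-- Join K₁ * K₂ : vertices Fin (size K₁ + size K₂) = disjoint union
-- (first block = V(K₁), second block = V(K₂)).
JoinAdj' : (K₁ K₂ : Graph) → Fin (size K₁) ⊎ Fin (size K₂) →
           Fin (size K₁) ⊎ Fin (size K₂) → Set
JoinAdj' K₁ K₂ (inj₁ p) (inj₁ q) = Adj K₁ p q
JoinAdj' K₁ K₂ (inj₂ p) (inj₂ q) = Adj K₂ p q
JoinAdj' K₁ K₂ (inj₁ p) (inj₂ q) = ⊤
JoinAdj' K₁ K₂ (inj₂ p) (inj₁ q) = ⊤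

private
  joinSym : (K₁ K₂ : Graph) → ∀ a b → JoinAdj' K₁ K₂ a b → JoinAdj' K₁ K₂ b a
  joinSym K₁ K₂ (inj₁ p) (inj₁ q) e = sym K₁ e
  joinSym K₁ K₂ (inj₂ p) (inj₂ q) e = sym K₂ e
  joinSym K₁ K₂ (inj₁ p) (inj₂ q) e = _
  joinSym K₁ K₂ (inj₂ p) (inj₁ q) e = _

  joinIrr : (K₁ K₂ : Graph) → ∀ a → ¬ JoinAdj' K₁ K₂ a a
  joinIrr K₁ K₂ (inj₁ p) e = irrefl K₁ e
  joinIrr K₁ K₂ (inj₂ p) e = irrefl K₂ e

_*ᴳ_ : Graph → Graph → Graph
K₁ *ᴳ K₂ = record
  { size   = size K₁ ℕ.+ size K₂
  ; Adj    = λ x y → JoinAdj' K₁ K₂ (splitAt (size K₁) x) (splitAt (size K₁) y)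
  ; sym    = λ {x} {y} → joinSym K₁ K₂ (splitAt (size K₁) x) (splitAt (size K₁) y)
  ; irrefl = λ {x} → joinIrr K₁ K₂ (splitAt (size K₁) x)
  }

QAdj : ∀ {n} → Vec Bool n → Vec Bool n → Set
QAdj {n} u v = Σ (Fin n) λ i → v ≡ updateAt u i Data.Bool.not

allVecs : (n : ℕ) → List (Vec Bool n)
allVecs zero    = [] ∷ []
allVecs (suc n) = map (false ∷_) (allVecs n) ++ map (true ∷_) (allVecs n)

allB : {A : Set} → (A → Bool) → List A → Bool
allB p = foldr (λ a b → p a ∧ b) true

-- Singular cubes (raw vertex maps; being a graph homomorphism is a
-- separate predicate).

RawCube : Graph → ℕ → Set
RawCube G n = Vec Bool n → Fin (size G)

IsHom : (G : Graph) {n : ℕ} → RawCube G n → Set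
IsHom G σ = ∀ u v → QAdj u v → σ u ≡ σ v ⊎ Adj G (σ u) (σ v)

-- face f_{i+1}^ε (the paper indexes faces by 1..n; Fin uses 0..n-1)
face : (G : Graph) {n : ℕ} → Fin (suc n) → Bool → RawCube G (suc n) → RawCube G n
face G i ε σ a = σ (insertAt a i ε)

Degenerate : (G : Graph) {n : ℕ} → RawCube G n → Set
Degenerate G {zero}  σ = ⊥
Degenerate G {suc n} σ = Σ (Fin (suc n)) λ i → ∀ a → face G i true σ a ≡ face G i false σ a

cubeEqB : (G : Graph) {n : ℕ} → RawCube G n → RawCube G n → Bool
cubeEqB G {n} σ τ = allB (λ v → ⌊ σ v Fin.≟ τ v ⌋) (allVecs n)

module _ {c ℓ : Level} (R : CommutativeRing c ℓ) where
  open CommutativeRing R using (Carrier; _≈_; _+_; _*_; -_; 0#; 1#)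

  Formal : Set → Set c
  Formal B = List (Carrier × B)

  sign : ℕ → Carrier
  sign zero          = 1#
  sign (suc zero)    = - 1#
  sign (suc (suc k)) = sign k

  coeffWith : {B : Set} → (B → B → Bool) → Formal B → B → Carrier
  coeffWith eq x b = foldr (λ { (r , b') s → (if eq b' b then r else 0#) + s }) 0# x

  linExt : {A B : Set} → (A → Formal B) → Formal A → Formal B
  linExt f = concatMap (λ { (r , a) → map (λ { (s , b) → (r * s , b) }) (f a) })

  CChain : Graph → ℕ → Set c
  CChain G n = Formal (RawCube G n)

  ValidCChain : (G : Graph) {n : ℕ} → CChain G n → Set
  ValidCChain G [] = ⊤
  ValidCChain G ((r , σ) ∷ x) = IsHom G σ × ValidCChain G x

  ∂cube : (G : Graph) {n : ℕ} → RawCube G (suc n) → CChain G n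
  ∂cube G {n} σ = concatMap
    (λ i → (sign (suc (toℕ i)) , face G i false σ)
         ∷ (- sign (suc (toℕ i)) , face G i true σ) ∷ [])
    (allFin (suc n))

  ∂C : (G : Graph) {n : ℕ} → CChain G (suc n) → CChain G n
  ∂C G = linExt (∂cube G)

  coeffC : (G : Graph) {n : ℕ} → CChain G n → RawCube G n → Carrier
  coeffC G = coeffWith (cubeEqB G)

  -- equality in C^Cube_n(G) = L_n(G) / degenerate cubes
  EqC : (G : Graph) {n : ℕ} → CChain G n → CChain G n → Set ℓ
  EqC G {n} x y = ∀ (σ : RawCube G n) → IsHom G σ → ¬ Degenerate G σ →
                     coeffC G x σ ≈ coeffC G y σ

  CubeHomologyVanishes : Graph → ℕ → Set (c Level.⊔ ℓ)
  CubeHomologyVanishes G zero    = (x : CChain G zero) → ValidCChain G x →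
    Σ (CChain G 1) λ y → ValidCChain G y × EqC G (∂C G y) x
  CubeHomologyVanishes G (suc n) = (x : CChain G (suc n)) → ValidCChain G x →
    EqC G (∂C G x) [] →
    Σ (CChain G (suc (suc n))) λ y → ValidCChain G y × EqC G (∂C G y) x

  PChain : Graph → ℕ → Set c
  PChain G n = Formal (Vec (Fin (size G)) (suc n))

  Repeats : ∀ {m k} → Vec (Fin m) k → Set
  Repeats [] = ⊥
  Repeats (v ∷ []) = ⊥
  Repeats (v ∷ w ∷ vs) = v ≡ w ⊎ Repeats (w ∷ vs)

  Allowed : (G : Graph) {k : ℕ} → Vec (Fin (size G)) k → Set
  Allowed G [] = ⊤
  Allowed G (v ∷ []) = ⊤
  Allowed G (v ∷ w ∷ vs) = Adj G v w × Allowed G (w ∷ vs)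

  ∂tuple : (G : Graph) {n : ℕ} → Vec (Fin (size G)) (suc (suc n)) → PChain G n
  ∂tuple G {n} v = map (λ i → (sign (toℕ i) , removeAt v i)) (allFin (suc (suc n)))

  ∂P : (G : Graph) {n : ℕ} → PChain G (suc n) → PChain G n
  ∂P G = linExt (∂tuple G)

  coeffP : (G : Graph) {n : ℕ} → PChain G n → Vec (Fin (size G)) (suc n) → Carrier
  coeffP G = coeffWith (λ u v → ⌊ VecP.≡-dec Fin._≟_ u v ⌋)

  -- equality in C_n(V) = free module on tuples / tuples with repeats
  EqP : (G : Graph) {n : ℕ} → PChain G n → PChain G n → Set ℓ
  EqP G {n} x y = ∀ (t : Vec (Fin (size G)) (suc n)) → ¬ Repeats t →
                     coeffP G x t ≈ coeffP G y t

  -- x ∈ \tilde C_n(G): the class of x lies in the span of allowed paths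
  InAllowed : (G : Graph) {n : ℕ} → PChain G n → Set ℓ
  InAllowed G {n} x = ∀ (t : Vec (Fin (size G)) (suc n)) → ¬ Repeats t →
                      ¬ Allowed G t → coeffP G x t ≈ 0#

  -- x ∈ C^Path_n(G)  (with \tilde C_{-1} = 0)
  InPathChains : (G : Graph) (n : ℕ) → PChain G n → Set ℓ
  InPathChains G zero    x = InAllowed G x
  InPathChains G (suc n) x = InAllowed G x × InAllowed G (∂P G x)

  PathHomologyVanishes : Graph → ℕ → Set (c Level.⊔ ℓ)
  PathHomologyVanishes G zero    = (x : PChain G zero) → InPathChains G zero x →
    Σ (PChain G 1) λ y → InPathChains G 1 y × EqP G (∂P G y) x
  PathHomologyVanishes G (suc n) = (x : PChain G (suc n)) → InPathChains G (suc n) x →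
    EqP G (∂P G x) [] →
    Σ (PChain G (suc (suc n))) λ y → InPathChains G (suc (suc n)) y × EqP G (∂P G y) x

-- Pick a ∈ K₁ and b ∈ K₂ and let g send every vertex of K₁ to b and every vertex of K₂ to a.
-- Then g is a graph map, each x is adjacent to g x, and g x is a or adjacent to a, so
-- id ≃ g ≃ const a through two one-step homotopies, and both homologies see this as a chain
-- contraction s. For path homology, s is the prism of id ≃ g followed by the cone with apex a,
-- with ∂s + s∂ = id; it sends allowed or repeating tuples to allowed or repeating tuples. For
-- cubical homology, s is made of the two cylinders σ × [0,1] → G, with ∂s + s∂ = id − const a ∘ _,
-- and const a ∘ σ is degenerate in positive dimension. Chains are formal sums compared through
-- their coefficients, so each chain identity is proved by evaluating an arbitrary functional on
-- the generators.

module Submission where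

open import Defs hiding (sym)
open import Level using (Level)
open import Algebra.Bundles using (CommutativeRing)
open import Data.Nat as ℕ using (ℕ; suc; zero; _≤_; z≤n; s≤s)
open import Data.Product using (_×_; _,_; proj₁; proj₂)

open import Data.Bool using (Bool; true; false; if_then_else_; not)
import Data.Nat.Properties as ℕ
open import Data.Integer as ℤ using (ℤ; +_; -[1+_]; _⊖_)
import Data.Integer.Properties as ℤ
open import Data.Fin as Fin using (Fin; zero; suc; toℕ; splitAt; _↑ˡ_; _↑ʳ_)
import Data.Fin.Properties as Fin
open import Data.List using (List; []; _∷_; _++_; map; concatMap; tabulate; length)
open import Data.List.Relation.Unary.All as All using (All; []; _∷_)
import Data.List.Relation.Unary.All.Properties as AllP
open import Data.Vec as Vec using (Vec; []; _∷_; removeAt; insertAt; updateAt)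
import Data.Vec.Properties as Vec
open import Data.List.Relation.Unary.Any using (here)
open import Data.List.Membership.Propositional using (_∈_)
open import Data.List.Membership.Propositional.Properties using (∈-map⁺; ∈-++⁺ˡ; ∈-++⁺ʳ)
open import Data.Maybe using (Maybe; just; nothing)
open import Data.Sum using (_⊎_; inj₁; inj₂)
open import Data.Empty using (⊥-elim)
open import Data.Unit using (⊤; tt)
open import Function using (_∘_; id; const; case_of_)
open import Relation.Binary.Core using (_Preserves_⟶_)
open import Relation.Binary.Definitions using (_Respects_)
open import Relation.Binary.Structures using (IsEquivalence)
open import Relation.Nullary using (¬_; Dec; yes; no)
open import Relation.Nullary.Decidable using (⌊_⌋; dec-true; isYes≗does)
import Relation.Binary.PropositionalEquality as ≡
open ≡ using (_≡_; _≗_)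

-- The ring solver needs coefficients with decidable equality; ℤ acts on every ring through n ↦ n · 1#.
module IntegerCoefficientSolver {c ℓ} (R : CommutativeRing c ℓ) where
  open CommutativeRing R
  open import Algebra.Properties.Ring ring using (-0#≈0#; -‿involutive; -‿+-comm; -‿distribˡ-*; -‿distribʳ-*)
  open import Algebra.Properties.CommutativeSemigroup +-commutativeSemigroup using (interchange)
  open import Algebra.Properties.Semiring.Mult semiring using (×-homo-+; ×1-homo-*) renaming (_×_ to _·_)
  open import Algebra.Solver.Ring.AlmostCommutativeRing using (fromCommutativeRing; _-Raw-AlmostCommutative⟶_)
  open import Relation.Binary.Reasoning.Setoid setoid

  fromℕ : ℕ → Carrier
  fromℕ n = n · 1#

  fromℤ : ℤ → Carrier
  fromℤ (+ n)      = fromℕ n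
  fromℤ -[1+ n ]   = - fromℕ (suc n)

  fromℤ-⊖ : ∀ m n → fromℤ (m ⊖ n) ≈ fromℕ m - fromℕ n
  fromℤ-⊖ m zero = begin
    fromℤ (m ⊖ 0)   ≡⟨ ≡.cong fromℤ (ℤ.⊖-≥ {m} z≤n) ⟩
    fromℕ m         ≈⟨ +-identityʳ _ ⟨
    fromℕ m + 0#    ≈⟨ +-congˡ -0#≈0# ⟨
    fromℕ m - 0#    ∎
  fromℤ-⊖ zero (suc n) = sym (+-identityˡ _)
  fromℤ-⊖ (suc m) (suc n) = begin
    fromℤ (suc m ⊖ suc n)             ≡⟨ ≡.cong fromℤ (ℤ.[1+m]⊖[1+n]≡m⊖n m n) ⟩
    fromℤ (m ⊖ n)                     ≈⟨ fromℤ-⊖ m n ⟩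
    fromℕ m - fromℕ n                 ≈⟨ +-identityˡ _ ⟨
    0# + (fromℕ m - fromℕ n)          ≈⟨ +-congʳ (-‿inverseʳ 1#) ⟨
    (1# - 1#) + (fromℕ m - fromℕ n)   ≈⟨ interchange _ _ _ _ ⟩
    fromℕ (suc m) + (- 1# - fromℕ n)  ≈⟨ +-congˡ (-‿+-comm _ _) ⟩
    fromℕ (suc m) - fromℕ (suc n)     ∎

  fromℤ-+ : ∀ i j → fromℤ (i ℤ.+ j) ≈ fromℤ i + fromℤ j
  fromℤ-+ (+ m)    (+ n)    = ×-homo-+ 1# m n
  fromℤ-+ (+ m)    -[1+ n ] = fromℤ-⊖ m (suc n)
  fromℤ-+ -[1+ m ] (+ n)    = trans (fromℤ-⊖ n (suc m)) (+-comm _ _)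
  fromℤ-+ -[1+ m ] -[1+ n ] = begin
    - fromℕ (suc (suc (m ℕ.+ n)))     ≡⟨ ≡.cong (λ k → - fromℕ (suc k)) (ℕ.+-suc m n) ⟨
    - fromℕ (suc m ℕ.+ suc n)         ≈⟨ -‿cong (×-homo-+ 1# (suc m) (suc n)) ⟩
    - (fromℕ (suc m) + fromℕ (suc n)) ≈⟨ -‿+-comm _ _ ⟨
    - fromℕ (suc m) - fromℕ (suc n)   ∎

  fromℤ-neg : ∀ i → fromℤ (ℤ.- i) ≈ - fromℤ i
  fromℤ-neg (+ zero)  = sym -0#≈0#
  fromℤ-neg (+ suc n) = refl
  fromℤ-neg -[1+ n ]  = sym (-‿involutive _)

  fromℤ-* : ∀ i j → fromℤ (i ℤ.* j) ≈ fromℤ i * fromℤ j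
  fromℤ-* (+ m)        (+ n)        = trans (reflexive (≡.cong fromℤ (ℤ.+◃n≡+n (m ℕ.* n)))) (×1-homo-* m n)
  fromℤ-* (+ zero)     -[1+ n ]     = sym (zeroˡ _)
  fromℤ-* (+ suc m)    -[1+ n ]     = trans (-‿cong (×1-homo-* (suc m) (suc n))) (-‿distribʳ-* _ _)
  fromℤ-* -[1+ m ]     (+ zero)     = trans (reflexive (≡.cong fromℤ (ℤ.*-zeroʳ -[1+ m ]))) (sym (zeroʳ _))
  fromℤ-* -[1+ m ]     (+ suc n)    = trans (-‿cong (×1-homo-* (suc m) (suc n))) (-‿distribˡ-* _ _)
  fromℤ-* -[1+ m ]     -[1+ n ]     = begin
    fromℕ (suc m ℕ.* suc n)             ≈⟨ ×1-homo-* (suc m) (suc n) ⟩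
    fromℕ (suc m) * fromℕ (suc n)       ≈⟨ -‿involutive _ ⟨
    - - (fromℕ (suc m) * fromℕ (suc n)) ≈⟨ -‿cong (-‿distribˡ-* _ _) ⟩
    - (- fromℕ (suc m) * fromℕ (suc n)) ≈⟨ -‿distribʳ-* _ _ ⟩
    - fromℕ (suc m) * - fromℕ (suc n)   ∎

  fromℤ-homomorphism : ℤ.+-*-rawRing -Raw-AlmostCommutative⟶ fromCommutativeRing R
  fromℤ-homomorphism = record
    { ⟦_⟧ = fromℤ ; +-homo = fromℤ-+ ; *-homo = fromℤ-* ; -‿homo = fromℤ-neg
    ; 0-homo = refl ; 1-homo = +-identityʳ 1# }

  fromℤ-cong : ∀ i j → Maybe (fromℤ i ≈ fromℤ j)
  fromℤ-cong i j with i ℤ.≟ j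
  ... | yes i≡j = just (reflexive (≡.cong fromℤ i≡j))
  ... | no _    = nothing

  open import Algebra.Solver.Ring ℤ.+-*-rawRing (fromCommutativeRing R) fromℤ-homomorphism fromℤ-cong public

module LinearFunctionals {c ℓ} (R : CommutativeRing c ℓ) where
  open CommutativeRing R hiding (zero)
  open IntegerCoefficientSolver R using (solve; _:=_; _:+_; _:*_)
  open import Algebra.Properties.CommutativeSemigroup +-commutativeSemigroup using (interchange)
  open import Algebra.Properties.Ring ring using (-0#≈0#; -‿involutive; -‿+-comm; -‿distribˡ-*; -‿distribʳ-*)
  open import Algebra.Properties.Monoid.Sum +-monoid using (sum; sum-cong-≋) public
  open import Relation.Binary.Reasoning.Setoid setoid

  x-0#≈x : ∀ x → x - 0# ≈ x
  x-0#≈x x = trans (+-congˡ -0#≈0#) (+-identityʳ x)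

  eval : {B : Set} → (B → Carrier) → Formal R B → Carrier
  eval φ []            = 0#
  eval φ ((r , b) ∷ x) = r * φ b + eval φ x

  negate : {B : Set} → Formal R B → Formal R B
  negate = map (λ (r , b) → (- r , b))

  relabel : {A B : Set} → (A → B) → Formal R A → Formal R B
  relabel f = map (λ (r , a) → (r , f a))

  module _ {B : Set} where

    eval-cong : {φ ψ : B → Carrier} → (∀ b → φ b ≈ ψ b) → ∀ x → eval φ x ≈ eval ψ x
    eval-cong φ≈ψ []            = refl
    eval-cong φ≈ψ ((r , b) ∷ x) = +-cong (*-congˡ (φ≈ψ b)) (eval-cong φ≈ψ x)

    eval-++ : ∀ (φ : B → Carrier) x y → eval φ (x ++ y) ≈ eval φ x + eval φ y
    eval-++ φ []            y = sym (+-identityˡ _)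
    eval-++ φ ((r , b) ∷ x) y = trans (+-congˡ (eval-++ φ x y)) (sym (+-assoc _ _ _))

    eval-+ : ∀ (φ ψ : B → Carrier) x → eval (λ b → φ b + ψ b) x ≈ eval φ x + eval ψ x
    eval-+ φ ψ []            = sym (+-identityʳ _)
    eval-+ φ ψ ((r , b) ∷ x) = trans (+-cong (distribˡ _ _ _) (eval-+ φ ψ x)) (interchange _ _ _ _)

    eval-neg : ∀ (φ : B → Carrier) x → eval (λ b → - φ b) x ≈ - eval φ x
    eval-neg φ []            = sym -0#≈0#
    eval-neg φ ((r , b) ∷ x) = trans (+-cong (sym (-‿distribʳ-* _ _)) (eval-neg φ x)) (-‿+-comm _ _)

    eval-sub : ∀ (φ ψ : B → Carrier) x → eval (λ b → φ b - ψ b) x ≈ eval φ x - eval ψ x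
    eval-sub φ ψ x = trans (eval-+ φ (λ b → - ψ b) x) (+-congˡ (eval-neg ψ x))

    eval-zero : {φ : B → Carrier} → (∀ b → φ b ≈ 0#) → ∀ x → eval φ x ≈ 0#
    eval-zero φ≈0 []            = refl
    eval-zero φ≈0 ((r , b) ∷ x) =
      trans (+-cong (trans (*-congˡ (φ≈0 b)) (zeroʳ _)) (eval-zero φ≈0 x)) (+-identityˡ _)

    eval-negate : ∀ (φ : B → Carrier) x → eval φ (negate x) ≈ - eval φ x
    eval-negate φ []            = sym -0#≈0#
    eval-negate φ ((r , b) ∷ x) =
      trans (+-cong (sym (-‿distribˡ-* _ _)) (eval-negate φ x)) (-‿+-comm _ _)

  eval-relabel : {A B : Set} (f : A → B) (φ : B → Carrier) (x : Formal R A) →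
                 eval φ (relabel f x) ≈ eval (φ ∘ f) x
  eval-relabel f φ []            = refl
  eval-relabel f φ ((r , a) ∷ x) = +-congˡ (eval-relabel f φ x)

  eval-scaled : {B : Set} (k : Carrier) (φ : B → Carrier) (x : Formal R B) →
                eval φ (map (λ p → (k * proj₁ p , proj₂ p)) x) ≈ k * eval φ x
  eval-scaled k φ []            = sym (zeroʳ _)
  eval-scaled k φ ((s , b) ∷ x) =
    trans (+-cong (*-assoc _ _ _) (eval-scaled k φ x)) (sym (distribˡ _ _ _))

  eval-linExt : {A B : Set} (f : A → Formal R B) (φ : B → Carrier) (x : Formal R A) →
                eval φ (linExt R f x) ≈ eval (λ a → eval φ (f a)) x
  eval-linExt f φ []            = refl
  eval-linExt f φ ((r , a) ∷ x) = trans (eval-++ φ r·fa (linExt R f x))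
    (+-cong (eval-scaled r φ (f a)) (eval-linExt f φ x))
    where r·fa = map (λ p → (r * proj₁ p , proj₂ p)) (f a)

  indicator : {B : Set} → (B → B → Bool) → B → B → Carrier
  indicator eq t b = if eq b t then 1# else 0#

  coeffWith≈eval-indicator : {B : Set} (eq : B → B → Bool) (x : Formal R B) (t : B) →
                             coeffWith R eq x t ≈ eval (indicator eq t) x
  coeffWith≈eval-indicator eq []            t = refl
  coeffWith≈eval-indicator eq ((r , b) ∷ x) t with eq b t
  ... | true  = +-cong (sym (*-identityʳ _)) (coeffWith≈eval-indicator eq x t)
  ... | false = +-cong (sym (zeroʳ _)) (coeffWith≈eval-indicator eq x t)

  sign-suc : ∀ k → sign R (suc k) ≈ - sign R k
  sign-suc zero    = refl
  sign-suc (suc k) = sym (trans (-‿cong (sign-suc k)) (-‿involutive _))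

  sum-neg : ∀ n (f : Fin n → Carrier) → sum (λ i → - f i) ≈ - sum f
  sum-neg zero    f = sym -0#≈0#
  sum-neg (suc n) f = trans (+-congˡ (sum-neg n (f ∘ suc))) (-‿+-comm _ _)

  module _ {A B : Set} where

    eval-concatMap-tabulate : ∀ n (F : A → Formal R B) (h : Fin n → A) (φ : B → Carrier) →
                              eval φ (concatMap F (tabulate h)) ≈ sum (λ i → eval φ (F (h i)))
    eval-concatMap-tabulate zero    F h φ = refl
    eval-concatMap-tabulate (suc n) F h φ =
      trans (eval-++ φ (F (h zero)) _) (+-congˡ (eval-concatMap-tabulate n F (h ∘ suc) φ))

    eval-map-tabulate : ∀ n (F : A → Carrier × B) (h : Fin n → A) (φ : B → Carrier) →
                        eval φ (map F (tabulate h)) ≈ sum (λ i → proj₁ (F (h i)) * φ (proj₂ (F (h i))))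
    eval-map-tabulate zero    F h φ = refl
    eval-map-tabulate (suc n) F h φ = +-congˡ (eval-map-tabulate n F (h ∘ suc) φ)

  module Annihilation {B : Set} {_~_ : B → B → Set} (~-equiv : IsEquivalence _~_)
    (eq : B → B → Bool) (eq⇒~ : ∀ {a b} → eq a b ≡ true → a ~ b)
    (~⇒eq : ∀ {a b} → a ~ b → eq a b ≡ true) where

    open IsEquivalence ~-equiv renaming (refl to ~-refl; sym to ~-sym; trans to ~-trans)

    private
      contradiction-on : ∀ {a b p} {X : Set p} → eq a b ≡ false → a ~ b → X
      contradiction-on eq≡false a~b with ≡.trans (≡.sym eq≡false) (~⇒eq a~b)
      ... | ()

    removeClass : B → Formal R B → Formal R B
    removeClass a []            = []
    removeClass a ((r , b) ∷ z) = if eq b a then removeClass a z else (r , b) ∷ removeClass a z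

    removeClass-head : ∀ a r z → removeClass a ((r , a) ∷ z) ≡ removeClass a z
    removeClass-head a r z rewrite ~⇒eq (~-refl {a}) = ≡.refl

    length-removeClass : ∀ a z → length (removeClass a z) ≤ length z
    length-removeClass a []            = z≤n
    length-removeClass a ((r , b) ∷ z) with eq b a
    ... | true  = ℕ.m≤n⇒m≤1+n (length-removeClass a z)
    ... | false = s≤s (length-removeClass a z)

    eval-removeClass-same : ∀ a c → c ~ a → ∀ z → eval (indicator eq c) (removeClass a z) ≈ 0#
    eval-removeClass-same a c c~a []            = refl
    eval-removeClass-same a c c~a ((r , b) ∷ z) with eq b a in b≁a
    ... | true  = eval-removeClass-same a c c~a z
    ... | false with eq b c in b~c
    ...   | true  = contradiction-on b≁a (~-trans (eq⇒~ b~c) c~a)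
    ...   | false = trans (+-cong (zeroʳ r) (eval-removeClass-same a c c~a z)) (+-identityˡ _)

    eval-removeClass-other : ∀ a c → eq c a ≡ false → ∀ z →
                             eval (indicator eq c) (removeClass a z) ≈ eval (indicator eq c) z
    eval-removeClass-other a c c≁a []            = refl
    eval-removeClass-other a c c≁a ((r , b) ∷ z) with eq b a in b~a
    ... | false = +-congˡ (eval-removeClass-other a c c≁a z)
    ... | true with eq b c in b~c
    ...   | true  = contradiction-on c≁a (~-trans (~-sym (eq⇒~ b~c)) (eq⇒~ b~a))
    ...   | false = trans (eval-removeClass-other a c c≁a z) (sym (trans (+-congʳ (zeroʳ r)) (+-identityˡ _)))

    eval-split : (ψ : B → Carrier) → ψ Preserves _~_ ⟶ _≈_ → ∀ a z →
                 eval ψ z ≈ eval (indicator eq a) z * ψ a + eval ψ (removeClass a z)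
    eval-split ψ resp a []            = sym (trans (+-congʳ (zeroˡ _)) (+-identityˡ _))
    eval-split ψ resp a ((r , b) ∷ z) with eq b a in b~a
    ... | true = begin
      r * ψ b + eval ψ z                              ≈⟨ +-cong (*-congˡ (resp (eq⇒~ b~a))) (eval-split ψ resp a z) ⟩
      r * ψ a + (X * ψ a + eval ψ (removeClass a z))  ≈⟨ solve 4 (λ r P X D → r :* P :+ (X :* P :+ D) := (r :+ X) :* P :+ D)
                                                                 refl r (ψ a) X _ ⟩
      (r + X) * ψ a + eval ψ (removeClass a z)        ≈⟨ +-congʳ (*-congʳ (+-congʳ (*-identityʳ r))) ⟨
      (r * 1# + X) * ψ a + eval ψ (removeClass a z)   ∎
      where X = eval (indicator eq a) z
    ... | false = begin
      r * ψ b + eval ψ z                              ≈⟨ +-congˡ (eval-split ψ resp a z) ⟩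
      r * ψ b + (X * ψ a + eval ψ (removeClass a z))  ≈⟨ solve 4 (λ Y P X D → Y :+ (X :* P :+ D) := X :* P :+ (Y :+ D))
                                                                 refl (r * ψ b) (ψ a) X _ ⟩
      X * ψ a + (r * ψ b + eval ψ (removeClass a z))  ≈⟨ +-congʳ (*-congʳ (trans (+-congʳ (zeroʳ r)) (+-identityˡ X))) ⟨
      (r * 0# + X) * ψ a + (r * ψ b + eval ψ (removeClass a z)) ∎
      where X = eval (indicator eq a) z

    eval≈0-if-disjoint : (ψ : B → Carrier) → ψ Preserves _~_ ⟶ _≈_ → ∀ z →
                         (∀ a → eval (indicator eq a) z ≈ 0# ⊎ ψ a ≈ 0#) → eval ψ z ≈ 0#
    eval≈0-if-disjoint ψ resp z = go (length z) z ℕ.≤-refl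
      where
      go : ∀ n z → length z ≤ n → (∀ a → eval (indicator eq a) z ≈ 0# ⊎ ψ a ≈ 0#) → eval ψ z ≈ 0#
      go n       []            _          _        = refl
      go (suc n) ((r , a) ∷ z) (s≤s |z|≤n) disjoint = begin
        eval ψ ((r , a) ∷ z)                                                    ≈⟨ eval-split ψ resp a ((r , a) ∷ z) ⟩
        eval (indicator eq a) ((r , a) ∷ z) * ψ a + eval ψ (removeClass a ((r , a) ∷ z))
                                                                                ≡⟨ ≡.cong (λ w → _ + eval ψ w) (removeClass-head a r z) ⟩
        eval (indicator eq a) ((r , a) ∷ z) * ψ a + eval ψ (removeClass a z)    ≈⟨ +-cong product≈0 rest≈0 ⟩
        0# + 0#                                                                 ≈⟨ +-identityˡ 0# ⟩
        0#                                                                      ∎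
        where
        product≈0 : eval (indicator eq a) ((r , a) ∷ z) * ψ a ≈ 0#
        product≈0 with disjoint a
        ... | inj₁ coeff≈0 = trans (*-congʳ coeff≈0) (zeroˡ _)
        ... | inj₂ ψa≈0    = trans (*-congˡ ψa≈0) (zeroʳ _)
        disjoint′ : ∀ c → eval (indicator eq c) (removeClass a z) ≈ 0# ⊎ ψ c ≈ 0#
        disjoint′ c with eq c a in c~a
        ... | true  = inj₁ (eval-removeClass-same a c (eq⇒~ c~a) z)
        ... | false with disjoint c
        ...   | inj₂ ψc≈0    = inj₂ ψc≈0
        ...   | inj₁ coeff≈0 = inj₁ (begin
          eval (indicator eq c) (removeClass a z)              ≡⟨ ≡.cong (eval (indicator eq c)) (removeClass-head a r z) ⟨
          eval (indicator eq c) (removeClass a ((r , a) ∷ z))  ≈⟨ eval-removeClass-other a c c~a ((r , a) ∷ z) ⟩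
          eval (indicator eq c) ((r , a) ∷ z)                  ≈⟨ coeff≈0 ⟩
          0#                                                   ∎)
        rest≈0 : eval ψ (removeClass a z) ≈ 0#
        rest≈0 = go n (removeClass a z) (ℕ.≤-trans (length-removeClass a z) |z|≤n) disjoint′

    -- H is kept as a hypothesis since it need not be decidable: allowedness depends on adjacency.
    eval-indicator≈0-or : {H : Set} {Q : B → Set} → Q Respects _~_ →
                          ∀ t z → (H → All (Q ∘ proj₂) z) → eval (indicator eq t) z ≈ 0# ⊎ (H → Q t)
    eval-indicator≈0-or Q-resp t []            all-Q = inj₁ refl
    eval-indicator≈0-or Q-resp t ((r , b) ∷ z) all-Q with eq b t in b~t
    ... | true  = inj₂ (λ h → Q-resp (eq⇒~ b~t) (All.head (all-Q h)))
    ... | false with eval-indicator≈0-or Q-resp t z (All.tail ∘ all-Q)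
    ...   | inj₁ rest≈0 = inj₁ (trans (+-cong (zeroʳ r) rest≈0) (+-identityˡ _))
    ...   | inj₂ Qt     = inj₂ Qt

  All-negate : {B : Set} {Q : B → Set} (x : Formal R B) → All (Q ∘ proj₂) x → All (Q ∘ proj₂) (negate x)
  All-negate x = AllP.map⁺ ∘ All.map id

  All-relabel : {A B : Set} {Q : B → Set} (f : A → B) (x : Formal R A) →
                All (Q ∘ f ∘ proj₂) x → All (Q ∘ proj₂) (relabel f x)
  All-relabel f x = AllP.map⁺ ∘ All.map id

  All-linExt : {A B : Set} {P : A → Set} {Q : B → Set} (f : A → Formal R B) →
               (∀ {a} → P a → All (Q ∘ proj₂) (f a)) → (x : Formal R A) →
               All (P ∘ proj₂) x → All (Q ∘ proj₂) (linExt R f x)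
  All-linExt f f-Q x = AllP.concat⁺ ∘ AllP.map⁺ ∘ All.map (AllP.map⁺ ∘ f-Q)

removeAt-map : ∀ {A B : Set} (f : A → B) {n} (w : Vec A (suc n)) (i : Fin (suc n)) →
               removeAt (Vec.map f w) i ≡ Vec.map f (removeAt w i)
removeAt-map f (x ∷ w)     zero    = ≡.refl
removeAt-map f (x ∷ y ∷ w) (suc i) = ≡.cong (f x ∷_) (removeAt-map f (y ∷ w) i)

⌊⌋-sound : ∀ {a} {A : Set a} (A? : Dec A) → ⌊ A? ⌋ ≡ true → A
⌊⌋-sound (yes a) _ = a

⌊⌋-complete : ∀ {a} {A : Set a} (A? : Dec A) → A → ⌊ A? ⌋ ≡ true
⌊⌋-complete A? a = ≡.trans (isYes≗does A?) (dec-true A? a)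

Near : (G : Graph) → Fin (size G) → Fin (size G) → Set
Near G x y = x ≡ y ⊎ Adj G x y

near-sym : (G : Graph) {x y : Fin (size G)} → Near G x y → Near G y x
near-sym G (inj₁ x≡y)  = inj₁ (≡.sym x≡y)
near-sym G (inj₂ x~y) = inj₂ (Graph.sym G x~y)

record TwoStepContraction (G : Graph) : Set where
  field
    centre                 : Fin (size G)
    retraction             : Fin (size G) → Fin (size G)
    retraction-hom         : ∀ {x y} → Adj G x y → Near G (retraction x) (retraction y)
    near-retraction        : ∀ x → Near G x (retraction x)
    retraction-near-centre : ∀ x → Near G (retraction x) centre

module PathHomologyOfContraction {G : Graph} (C : TwoStepContraction G) {c ℓ} (R : CommutativeRing c ℓ) where
  open TwoStepContraction C renaming (centre to a; retraction to g)
  open CommutativeRing R hiding (zero)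
  open LinearFunctionals R
  open IntegerCoefficientSolver R using (solve; _:=_; _:+_; _:-_)
  open import Algebra.Properties.Ring ring using (-‿distribˡ-*; -1*x≈-x)
  open import Algebra.Properties.Group +-group using (//-rightDividesʳ)
  open import Relation.Binary.Reasoning.Setoid setoid

  Tuple : ℕ → Set
  Tuple k = Vec (Fin (size G)) k

  -- δ φ = φ ∘ ∂, so the homotopy lemmas below are chain identities tested against every φ.
  δ : ∀ {m} → (Tuple (suc m) → Carrier) → Tuple (suc (suc m)) → Carrier
  δ φ v = eval φ (∂tuple R G v)

  δ-sum : ∀ {m} (φ : Tuple (suc m) → Carrier) (v : Tuple (suc (suc m))) →
          δ φ v ≈ sum (λ i → sign R (toℕ i) * φ (removeAt v i))
  δ-sum {m} φ v = eval-map-tabulate (suc (suc m)) (λ i → (sign R (toℕ i) , removeAt v i)) id φ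

  δ-cong : ∀ {m} {φ ψ : Tuple (suc m) → Carrier} → (∀ u → φ u ≈ ψ u) → ∀ v → δ φ v ≈ δ ψ v
  δ-cong φ≈ψ v = eval-cong φ≈ψ (∂tuple R G v)

  δ-cons : ∀ {m} (φ : Tuple (suc (suc m)) → Carrier) (v : Fin (size G)) (w : Tuple (suc (suc m))) →
           δ φ (v ∷ w) ≈ φ w - δ (φ ∘ (v ∷_)) w
  δ-cons {m} φ v w@(_ ∷ _) = begin
    δ φ (v ∷ w)                                       ≈⟨ δ-sum φ (v ∷ w) ⟩
    1# * φ w + sum (λ i → sign R (suc (toℕ i)) * φ′ i) ≈⟨ +-cong (*-identityˡ _) (sum-cong-≋ shifted-sign) ⟩
    φ w + sum (λ i → - (sign R (toℕ i) * φ′ i))        ≈⟨ +-congˡ (sum-neg (suc (suc m)) (λ i → sign R (toℕ i) * φ′ i)) ⟩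
    φ w - sum (λ i → sign R (toℕ i) * φ′ i)            ≈⟨ +-congˡ (-‿cong (δ-sum (φ ∘ (v ∷_)) w)) ⟨
    φ w - δ (φ ∘ (v ∷_)) w                             ∎
    where
    φ′ : Fin (suc (suc m)) → Carrier
    φ′ i = φ (v ∷ removeAt w i)
    shifted-sign : ∀ i → sign R (suc (toℕ i)) * φ′ i ≈ - (sign R (toℕ i) * φ′ i)
    shifted-sign i = trans (*-congʳ (sign-suc (toℕ i))) (sym (-‿distribˡ-* _ _))

  δ-map : ∀ {m} (f : Fin (size G) → Fin (size G)) (φ : Tuple (suc m) → Carrier) (w : Tuple (suc (suc m))) →
          δ φ (Vec.map f w) ≈ δ (φ ∘ Vec.map f) w
  δ-map f φ w = trans (δ-sum φ (Vec.map f w)) (trans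
    (sum-cong-≋ (λ i → *-congˡ {sign R (toℕ i)} (reflexive (≡.cong φ (removeAt-map f w i)))))
    (sym (δ-sum (φ ∘ Vec.map f) w)))

  δ-pair : (φ : Tuple 1 → Carrier) (x y : Fin (size G)) → δ φ (x ∷ y ∷ []) ≈ φ (y ∷ []) - φ (x ∷ [])
  δ-pair φ x y = +-cong (*-identityˡ _) (trans (+-identityʳ _) (-1*x≈-x _))

  δ-triple : (φ : Tuple 2 → Carrier) (x y z : Fin (size G)) →
             δ φ (x ∷ y ∷ z ∷ []) ≈ (φ (y ∷ z ∷ []) - φ (x ∷ z ∷ [])) + φ (x ∷ y ∷ [])
  δ-triple φ x y z = trans (+-cong (*-identityˡ _) (+-cong (-1*x≈-x _) (trans (+-identityʳ _) (*-identityˡ _))))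
    (sym (+-assoc _ _ _))

  -- prism (v₀ , … , vₘ) = Σᵢ (-1)ⁱ (v₀ , … , vᵢ , g vᵢ , … , g vₘ), the prism of the homotopy id ≃ g.
  prism : ∀ {m} → Tuple (suc m) → Formal R (Tuple (suc (suc m)))
  prism (v ∷ [])        = (1# , v ∷ g v ∷ []) ∷ []
  prism (v ∷ w@(_ ∷ _)) = (1# , v ∷ Vec.map g (v ∷ w)) ∷ negate (relabel (v ∷_) (prism w))

  eval-prism-vertex : (φ : Tuple 2 → Carrier) (v : Fin (size G)) → eval φ (prism (v ∷ [])) ≈ φ (v ∷ g v ∷ [])
  eval-prism-vertex φ v = trans (+-identityʳ _) (*-identityˡ _)

  eval-prism-cons : ∀ {m} (φ : Tuple (suc (suc (suc m))) → Carrier) (v : Fin (size G)) (w : Tuple (suc m)) →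
                    eval φ (prism (v ∷ w)) ≈ φ (v ∷ g v ∷ Vec.map g w) - eval (φ ∘ (v ∷_)) (prism w)
  eval-prism-cons φ v w@(_ ∷ _) = +-cong (*-identityˡ _)
    (trans (eval-negate φ (relabel (v ∷_) (prism w))) (-‿cong (eval-relabel (v ∷_) φ (prism w))))

  prism-homotopy : ∀ {m} (φ : Tuple (suc (suc m)) → Carrier) (v : Tuple (suc (suc m))) →
                   eval (δ φ) (prism v) + δ (eval φ ∘ prism) v ≈ φ (Vec.map g v) - φ v
  prism-homotopy φ (v₀ ∷ v₁ ∷ []) = begin
    eval (δ φ) (prism (v₀ ∷ v₁ ∷ [])) + δ (eval φ ∘ prism) (v₀ ∷ v₁ ∷ [])
      ≈⟨ +-cong (trans (eval-prism-cons (δ φ) v₀ (v₁ ∷ []))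
                       (+-cong (δ-triple φ v₀ (g v₀) (g v₁))
                               (-‿cong (trans (eval-prism-vertex (δ φ ∘ (v₀ ∷_)) v₁) (δ-triple φ v₀ v₁ (g v₁))))))
                (trans (δ-pair (eval φ ∘ prism) v₀ v₁) (+-cong (eval-prism-vertex φ v₁) (-‿cong (eval-prism-vertex φ v₀)))) ⟩
    (((p - q) + r) - ((s - q) + t)) + (s - r)
      ≈⟨ solve 5 (λ p q r s t → (((p :- q) :+ r) :- ((s :- q) :+ t)) :+ (s :- r) := p :- t) refl p q r s t ⟩
    p - t ∎
    where
    p = φ (g v₀ ∷ g v₁ ∷ [])
    q = φ (v₀ ∷ g v₁ ∷ [])
    r = φ (v₀ ∷ g v₀ ∷ [])
    s = φ (v₁ ∷ g v₁ ∷ [])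
    t = φ (v₀ ∷ v₁ ∷ [])
  prism-homotopy φ (v₀ ∷ w@(_ ∷ _ ∷ _)) = begin
    eval (δ φ) (prism (v₀ ∷ w)) + δ Ψ (v₀ ∷ w)
      ≈⟨ +-cong (trans (eval-prism-cons (δ φ) v₀ w) (+-cong δ-top δ-rest)) δ-Ψ ⟩
    ((A - (B - X)) - (E - F)) + (E - (X - H))
      ≈⟨ solve 6 (λ A B X E F H → ((A :- (B :- X)) :- (E :- F)) :+ (E :- (X :- H)) := (A :- B) :+ (F :+ H))
                 refl A B X E F H ⟩
    (A - B) + (F + H) ≈⟨ +-congˡ (prism-homotopy φ₀ w) ⟩
    (A - B) + (B - J) ≈⟨ solve 3 (λ A B J → (A :- B) :+ (B :- J) := A :- J) refl A B J ⟩
    A - J ∎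
    where
    φ₀ = φ ∘ (v₀ ∷_)
    Ψ  = eval φ ∘ prism
    A = φ (Vec.map g (v₀ ∷ w))
    B = φ₀ (Vec.map g w)
    X = δ (φ ∘ (v₀ ∷_) ∘ (g v₀ ∷_) ∘ Vec.map g) w
    E = eval φ (prism w)
    F = eval (δ φ₀) (prism w)
    H = δ (eval φ₀ ∘ prism) w
    J = φ (v₀ ∷ w)
    δ-top : δ φ (v₀ ∷ g v₀ ∷ Vec.map g w) ≈ A - (B - X)
    δ-top = trans (δ-cons φ v₀ (Vec.map g (v₀ ∷ w))) (+-congˡ (-‿cong (trans (δ-cons φ₀ (g v₀) (Vec.map g w))
              (+-congˡ (-‿cong (δ-map g (φ ∘ (v₀ ∷_) ∘ (g v₀ ∷_)) w))))))
    δ-rest : - eval (δ φ ∘ (v₀ ∷_)) (prism w) ≈ - (E - F)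
    δ-rest = -‿cong (trans (eval-cong (δ-cons φ v₀) (prism w)) (eval-sub φ (δ φ₀) (prism w)))
    δ-Ψ : δ Ψ (v₀ ∷ w) ≈ E - (X - H)
    δ-Ψ = trans (δ-cons Ψ v₀ w) (+-congˡ (-‿cong (trans (δ-cong (eval-prism-cons φ v₀) w)
            (eval-sub (φ ∘ (v₀ ∷_) ∘ (g v₀ ∷_) ∘ Vec.map g) (eval φ₀ ∘ prism) (∂tuple R G w)))))

  -- The cone with apex a on the retracted tuple, corrected by the prism of id ≃ g.
  nullHomotopy : ∀ {m} → Tuple (suc m) → Formal R (Tuple (suc (suc m)))
  nullHomotopy ρ = (1# , a ∷ Vec.map g ρ) ∷ negate (prism ρ)

  eval-nullHomotopy : ∀ {m} (φ : Tuple (suc (suc m)) → Carrier) (ρ : Tuple (suc m)) →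
                      eval φ (nullHomotopy ρ) ≈ φ (a ∷ Vec.map g ρ) - eval φ (prism ρ)
  eval-nullHomotopy φ ρ = +-cong (*-identityˡ _) (eval-negate φ (prism ρ))

  nullHomotopy-homotopy : ∀ {m} (φ : Tuple (suc (suc m)) → Carrier) (ρ : Tuple (suc (suc m))) →
                          eval (δ φ) (nullHomotopy ρ) + δ (eval φ ∘ nullHomotopy) ρ ≈ φ ρ
  nullHomotopy-homotopy φ ρ = begin
    eval (δ φ) (nullHomotopy ρ) + δ (eval φ ∘ nullHomotopy) ρ
      ≈⟨ +-cong (trans (eval-nullHomotopy (δ φ) ρ) (+-congʳ δ-cone)) δ-s ⟩
    ((A - X) - F) + (X - H)  ≈⟨ solve 4 (λ A X F H → ((A :- X) :- F) :+ (X :- H) := A :- (F :+ H)) refl A X F H ⟩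
    A - (F + H)              ≈⟨ +-congˡ (-‿cong (prism-homotopy φ ρ)) ⟩
    A - (A - φ ρ)            ≈⟨ solve 2 (λ A J → A :- (A :- J) := J) refl A (φ ρ) ⟩
    φ ρ                      ∎
    where
    A = φ (Vec.map g ρ)
    X = δ (φ ∘ (a ∷_) ∘ Vec.map g) ρ
    F = eval (δ φ) (prism ρ)
    H = δ (eval φ ∘ prism) ρ
    δ-cone : δ φ (a ∷ Vec.map g ρ) ≈ A - X
    δ-cone = trans (δ-cons φ a (Vec.map g ρ)) (+-congˡ (-‿cong (δ-map g (φ ∘ (a ∷_)) ρ)))
    δ-s : δ (eval φ ∘ nullHomotopy) ρ ≈ X - H
    δ-s = trans (δ-cong (eval-nullHomotopy φ) ρ) (eval-sub (φ ∘ (a ∷_) ∘ Vec.map g) (eval φ ∘ prism) (∂tuple R G ρ))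

  AllowedOrRepeats : ∀ {k} → Tuple k → Set
  AllowedOrRepeats u = Allowed R G u ⊎ Repeats R u

  map-repeats : ∀ {k} (f : Fin (size G) → Fin (size G)) (u : Tuple k) → Repeats R u → Repeats R (Vec.map f u)
  map-repeats f (v ∷ w ∷ u) (inj₁ v≡w) = inj₁ (≡.cong f v≡w)
  map-repeats f (v ∷ w ∷ u) (inj₂ rep) = inj₂ (map-repeats f (w ∷ u) rep)

  map-retraction-allowedOrRepeats : ∀ {k} (u : Tuple k) → Allowed R G u → AllowedOrRepeats (Vec.map g u)
  map-retraction-allowedOrRepeats []          _              = inj₁ _
  map-retraction-allowedOrRepeats (v ∷ [])    _              = inj₁ _
  map-retraction-allowedOrRepeats (v ∷ w ∷ u) (v~w , allowed)
    with retraction-hom v~w | map-retraction-allowedOrRepeats (w ∷ u) allowed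
  ... | inj₁ gv≡gw | _          = inj₂ (inj₁ gv≡gw)
  ... | inj₂ gv~gw | inj₁ alw   = inj₁ (gv~gw , alw)
  ... | inj₂ gv~gw | inj₂ rep   = inj₂ (inj₂ rep)

  cons-allowedOrRepeats : ∀ {k} x (u : Tuple (suc k)) → Near G x (Vec.head u) →
                          AllowedOrRepeats u → AllowedOrRepeats (x ∷ u)
  cons-allowedOrRepeats x (y ∷ u) (inj₁ x≡y) _          = inj₂ (inj₁ x≡y)
  cons-allowedOrRepeats x (y ∷ u) (inj₂ x~y) (inj₁ alw) = inj₁ (x~y , alw)
  cons-allowedOrRepeats x (y ∷ u) (inj₂ x~y) (inj₂ rep) = inj₂ (inj₂ rep)

  prism-head : ∀ {m} (ρ : Tuple (suc m)) → All ((_≡ Vec.head ρ) ∘ Vec.head ∘ proj₂) (prism ρ)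
  prism-head (v ∷ [])        = ≡.refl ∷ []
  prism-head (v ∷ w@(_ ∷ _)) =
    ≡.refl ∷ All-negate _ (All-relabel (v ∷_) (prism w) (All.map (λ _ → ≡.refl) (prism-head w)))

  prism-repeats : ∀ {m} (ρ : Tuple (suc m)) → Repeats R ρ → All (Repeats R ∘ proj₂) (prism ρ)
  prism-repeats (v ∷ w@(w₀ ∷ _)) rep = inj₂ (map-repeats g (v ∷ w) rep) ∷
    All-negate _ (All-relabel (v ∷_) (prism w) (repeats-after-v rep))
    where
    repeats-after-v : Repeats R (v ∷ w) → All (Repeats R ∘ (v ∷_) ∘ proj₂) (prism w)
    repeats-after-v (inj₁ v≡w₀) = All.map (λ { {_ , _ ∷ _} u₀≡w₀ → inj₁ (≡.trans v≡w₀ (≡.sym u₀≡w₀)) }) (prism-head w)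
    repeats-after-v (inj₂ rep)  = All.map (λ { {_ , _ ∷ _} r → inj₂ r }) (prism-repeats w rep)

  prism-allowedOrRepeats : ∀ {m} (ρ : Tuple (suc m)) → Allowed R G ρ → All (AllowedOrRepeats ∘ proj₂) (prism ρ)
  prism-allowedOrRepeats (v ∷ []) _ =
    cons-allowedOrRepeats v (g v ∷ []) (near-retraction v) (inj₁ _) ∷ []
  prism-allowedOrRepeats {suc m} (v ∷ w@(w₀ ∷ _)) (v~w₀ , allowed) =
    cons-allowedOrRepeats v (Vec.map g (v ∷ w)) (near-retraction v)
      (map-retraction-allowedOrRepeats (v ∷ w) (v~w₀ , allowed)) ∷
    All-negate (relabel (v ∷_) (prism w)) (All-relabel (v ∷_) (prism w)
      (All.map (λ {p} → extend {p}) (All.zip (prism-head w , prism-allowedOrRepeats w allowed))))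
    where
    extend : ∀ {p : Carrier × Tuple (suc (suc m))} →
             Vec.head (proj₂ p) ≡ w₀ × AllowedOrRepeats (proj₂ p) → AllowedOrRepeats (v ∷ proj₂ p)
    extend {_ , u} (u₀≡w₀ , alw) = cons-allowedOrRepeats v u (inj₂ (≡.subst (Adj G v) (≡.sym u₀≡w₀) v~w₀)) alw

  nullHomotopy-repeats : ∀ {m} (ρ : Tuple (suc m)) → Repeats R ρ → All (Repeats R ∘ proj₂) (nullHomotopy ρ)
  nullHomotopy-repeats ρ@(_ ∷ _) rep = inj₂ (map-repeats g ρ rep) ∷ All-negate (prism ρ) (prism-repeats ρ rep)

  nullHomotopy-allowedOrRepeats : ∀ {m} (ρ : Tuple (suc m)) → AllowedOrRepeats ρ →
                                  All (AllowedOrRepeats ∘ proj₂) (nullHomotopy ρ)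
  nullHomotopy-allowedOrRepeats ρ@(v ∷ _) (inj₁ alw) =
    cons-allowedOrRepeats a (Vec.map g ρ) (near-sym G (retraction-near-centre v))
      (map-retraction-allowedOrRepeats ρ alw) ∷
    All-negate (prism ρ) (prism-allowedOrRepeats ρ alw)
  nullHomotopy-allowedOrRepeats ρ (inj₂ rep) = All.map inj₂ (nullHomotopy-repeats ρ rep)

  tupleEq : ∀ {k} → Tuple k → Tuple k → Bool
  tupleEq u v = ⌊ Vec.≡-dec Fin._≟_ u v ⌋

  module TupleAnnihilation {k} = Annihilation {B = Tuple k} ≡.isEquivalence tupleEq
    (λ {u} {v} → ⌊⌋-sound (Vec.≡-dec Fin._≟_ u v)) (λ {u} {v} → ⌊⌋-complete (Vec.≡-dec Fin._≟_ u v))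
  open TupleAnnihilation using (eval≈0-if-disjoint; eval-indicator≈0-or)

  χ : ∀ {k} → Tuple k → Tuple k → Carrier
  χ = indicator tupleEq

  χ∘s : ∀ {m} → Tuple (suc (suc m)) → Tuple (suc m) → Carrier
  χ∘s t = eval (χ t) ∘ nullHomotopy

  χ∘s-resp : ∀ {m} (t : Tuple (suc (suc m))) → χ∘s t Preserves _≡_ ⟶ _≈_
  χ∘s-resp t = reflexive ∘ ≡.cong (χ∘s t)

  coeff-∂s : ∀ {m} (x : PChain R G (suc m)) t →
             coeffP R G (∂P R G (linExt R nullHomotopy x)) t ≈ coeffP R G x t - eval (χ∘s t) (∂P R G x)
  coeff-∂s x t = begin
    coeffP R G (∂P R G sx) t          ≈⟨ coeffWith≈eval-indicator tupleEq (∂P R G sx) t ⟩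
    eval (χ t) (∂P R G sx)            ≈⟨ eval-linExt (∂tuple R G) (χ t) sx ⟩
    eval (δ (χ t)) sx                 ≈⟨ eval-linExt nullHomotopy (δ (χ t)) x ⟩
    eval (eval (δ (χ t)) ∘ nullHomotopy) x    ≈⟨ eval-cong ∂s≈id-s∂ x ⟩
    eval (λ ρ → χ t ρ - δ (χ∘s t) ρ) x        ≈⟨ eval-sub (χ t) (δ (χ∘s t)) x ⟩
    eval (χ t) x - eval (δ (χ∘s t)) x         ≈⟨ +-cong (coeffWith≈eval-indicator tupleEq x t)
                                                        (-‿cong (eval-linExt (∂tuple R G) (χ∘s t) x)) ⟨
    coeffP R G x t - eval (χ∘s t) (∂P R G x)  ∎
    where
    sx = linExt R nullHomotopy x
    ∂s≈id-s∂ : ∀ ρ → eval (δ (χ t)) (nullHomotopy ρ) ≈ χ t ρ - δ (χ∘s t) ρ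
    ∂s≈id-s∂ ρ = trans (sym (//-rightDividesʳ (δ (χ∘s t) ρ) _)) (+-congʳ (nullHomotopy-homotopy (χ t) ρ))

  χ∘s-cycle≈0 : ∀ {m} (x : PChain R G (suc m)) → EqP R G (∂P R G x) [] →
                ∀ t → ¬ Repeats R t → eval (χ∘s t) (∂P R G x) ≈ 0#
  χ∘s-cycle≈0 x x-cycle t t-nonrep = eval≈0-if-disjoint (χ∘s t) (χ∘s-resp t) (∂P R G x) disjoint
    where
    disjoint : ∀ u → eval (χ u) (∂P R G x) ≈ 0# ⊎ χ∘s t u ≈ 0#
    disjoint u with eval-indicator≈0-or (≡.subst (Repeats R)) t (nullHomotopy u) (nullHomotopy-repeats u)
    ... | inj₁ χ∘s≈0         = inj₂ χ∘s≈0
    ... | inj₂ rep[u]⇒rep[t] = inj₁ (trans (sym (coeffWith≈eval-indicator tupleEq (∂P R G x) u))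
                                            (x-cycle u (t-nonrep ∘ rep[u]⇒rep[t])))

  nullHomotopy-inAllowed : ∀ {m} (x : PChain R G m) → InAllowed R G x → InAllowed R G (linExt R nullHomotopy x)
  nullHomotopy-inAllowed x x-allowed t t-nonrep t-nonallowed = begin
    coeffP R G (linExt R nullHomotopy x) t   ≈⟨ coeffWith≈eval-indicator tupleEq (linExt R nullHomotopy x) t ⟩
    eval (χ t) (linExt R nullHomotopy x)     ≈⟨ eval-linExt nullHomotopy (χ t) x ⟩
    eval (χ∘s t) x                           ≈⟨ eval≈0-if-disjoint (χ∘s t) (χ∘s-resp t) x disjoint ⟩
    0#                                       ∎
    where
    t-not-AR : ¬ AllowedOrRepeats t
    t-not-AR (inj₁ alw) = t-nonallowed alw
    t-not-AR (inj₂ rep) = t-nonrep rep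
    disjoint : ∀ ρ → eval (χ ρ) x ≈ 0# ⊎ χ∘s t ρ ≈ 0#
    disjoint ρ with eval-indicator≈0-or (≡.subst AllowedOrRepeats) t (nullHomotopy ρ) (nullHomotopy-allowedOrRepeats ρ)
    ... | inj₁ χ∘s≈0       = inj₂ χ∘s≈0
    ... | inj₂ AR[ρ]⇒AR[t] = inj₁ (trans (sym (coeffWith≈eval-indicator tupleEq x ρ))
                                          (x-allowed ρ (t-not-AR ∘ AR[ρ]⇒AR[t] ∘ inj₂) (t-not-AR ∘ AR[ρ]⇒AR[t] ∘ inj₁)))

  pathHomologyVanishes : ∀ n → PathHomologyVanishes R G (suc n)
  pathHomologyVanishes n x (x-allowed , _) x-cycle = y , (nullHomotopy-inAllowed x x-allowed , ∂y-allowed) , ∂y≈x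
    where
    y : PChain R G (suc (suc n))
    y = linExt R nullHomotopy x

    ∂y≈x : EqP R G (∂P R G y) x
    ∂y≈x t t-nonrep = trans (coeff-∂s x t) (trans (+-congˡ (-‿cong (χ∘s-cycle≈0 x x-cycle t t-nonrep))) (x-0#≈x _))

    ∂y-allowed : InAllowed R G (∂P R G y)
    ∂y-allowed t t-nonrep t-nonallowed = trans (∂y≈x t t-nonrep) (x-allowed t t-nonrep t-nonallowed)

allB-sound : {A : Set} (p : A → Bool) (l : List A) → allB p l ≡ true → All (λ a → p a ≡ true) l
allB-sound p []      _ = []
allB-sound p (a ∷ l) e with p a in pa
... | true  = pa ∷ allB-sound p l e
... | false = case e of λ ()

allB-complete : {A : Set} (p : A → Bool) → (∀ a → p a ≡ true) → (l : List A) → allB p l ≡ true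
allB-complete p p≡true []      = ≡.refl
allB-complete p p≡true (a ∷ l) rewrite p≡true a = allB-complete p p≡true l

allVecs-complete : ∀ n (v : Vec Bool n) → v ∈ allVecs n
allVecs-complete zero    []          = here ≡.refl
allVecs-complete (suc n) (false ∷ v) = ∈-++⁺ˡ (∈-map⁺ (false ∷_) (allVecs-complete n v))
allVecs-complete (suc n) (true ∷ v)  = ∈-++⁺ʳ (map (false ∷_) (allVecs n)) (∈-map⁺ (true ∷_) (allVecs-complete n v))

insertAt-updateAt : ∀ {n} (u : Vec Bool n) (i : Fin (suc n)) (j : Fin n) (ε : Bool) →
                    insertAt (updateAt u j not) i ε ≡ updateAt (insertAt u i ε) (Fin.punchIn i j) not
insertAt-updateAt u       zero    j       ε = ≡.refl
insertAt-updateAt (x ∷ u) (suc i) zero    ε = ≡.refl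
insertAt-updateAt (x ∷ u) (suc i) (suc j) ε = ≡.cong (x ∷_) (insertAt-updateAt u i j ε)

module CubicalHomologyOfContraction {G : Graph} (C : TwoStepContraction G) {c ℓ} (R : CommutativeRing c ℓ) where
  open TwoStepContraction C renaming (centre to a; retraction to g)
  open CommutativeRing R hiding (zero)
  open LinearFunctionals R
  open IntegerCoefficientSolver R using (solve; _:=_; _:+_; _:*_; _:-_; :-_; con)
  open import Algebra.Properties.Ring ring using (-‿involutive; -‿+-comm; -1*x≈-x)
  open import Algebra.Properties.Group +-group using (//-rightDividesʳ)
  open import Relation.Binary.Reasoning.Setoid setoid

  Vertex : Set
  Vertex = Fin (size G)

  cubeEq-sound : ∀ {m} {σ τ : RawCube G m} → cubeEqB G σ τ ≡ true → σ ≗ τ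
  cubeEq-sound {m} {σ} {τ} e v = ⌊⌋-sound (σ v Fin.≟ τ v) (All.lookup (allB-sound _ (allVecs m) e) (allVecs-complete m v))

  cubeEq-complete : ∀ {m} {σ τ : RawCube G m} → σ ≗ τ → cubeEqB G σ τ ≡ true
  cubeEq-complete {m} {σ} {τ} σ≗τ = allB-complete _ (λ v → ⌊⌋-complete (σ v Fin.≟ τ v) (σ≗τ v)) (allVecs m)

  ≗-isEquivalence : ∀ {m} → IsEquivalence (_≗_ {A = Vec Bool m} {B = Vertex})
  ≗-isEquivalence = record
    { refl = λ _ → ≡.refl ; sym = λ σ≗τ v → ≡.sym (σ≗τ v) ; trans = λ σ≗τ τ≗ρ v → ≡.trans (σ≗τ v) (τ≗ρ v) }

  isHom-resp : ∀ {m} {σ τ : RawCube G m} → σ ≗ τ → IsHom G σ → IsHom G τ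
  isHom-resp {σ = σ} {τ} σ≗τ σ-hom u v u~v rewrite ≡.sym (σ≗τ u) | ≡.sym (σ≗τ v) = σ-hom u v u~v

  face-hom : ∀ {m} (σ : RawCube G (suc m)) i ε → IsHom G σ → IsHom G (face G i ε σ)
  face-hom σ i ε σ-hom u v (j , v≡u+eⱼ) = σ-hom (insertAt u i ε) (insertAt v i ε)
    (Fin.punchIn i j , ≡.trans (≡.cong (λ w → insertAt w i ε) v≡u+eⱼ) (insertAt-updateAt u i j ε))

  -- The cube σ × [0,1] → G of a one-step homotopy from f₀ ∘ σ to f₁ ∘ σ; the new coordinate comes first.
  cylinder : ∀ {m} → (Vertex → Vertex) → (Vertex → Vertex) → RawCube G m → RawCube G (suc m)
  cylinder f₀ f₁ σ (t ∷ u) = if t then f₁ (σ u) else f₀ (σ u)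

  cylinder-resp : ∀ {m} f₀ f₁ {σ τ : RawCube G m} → σ ≗ τ → cylinder f₀ f₁ σ ≗ cylinder f₀ f₁ τ
  cylinder-resp f₀ f₁ σ≗τ (t ∷ u) rewrite σ≗τ u = ≡.refl

  face-cylinder : ∀ {m} f₀ f₁ (σ : RawCube G (suc m)) j ε →
                  face G (suc j) ε (cylinder f₀ f₁ σ) ≗ cylinder f₀ f₁ (face G j ε σ)
  face-cylinder f₀ f₁ σ j ε (t ∷ u) = ≡.refl

  degenerate-resp : ∀ {m} {σ τ : RawCube G m} → σ ≗ τ → Degenerate G σ → Degenerate G τ
  degenerate-resp {suc m} σ≗τ (i , σ-deg) = i , λ u →
    ≡.trans (≡.sym (σ≗τ (insertAt u i true))) (≡.trans (σ-deg u) (σ≗τ (insertAt u i false)))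

  cylinder-degenerate : ∀ {m} f₀ f₁ (σ : RawCube G m) → Degenerate G σ → Degenerate G (cylinder f₀ f₁ σ)
  cylinder-degenerate {suc m} f₀ f₁ σ (i , σ-deg) =
    suc i , λ { (t ∷ u) → ≡.cong (λ x → if t then f₁ x else f₀ x) (σ-deg u) }

  constant-degenerate : ∀ {m} (σ : RawCube G (suc m)) → Degenerate G (const a ∘ σ)
  constant-degenerate σ = zero , λ _ → ≡.refl

  HomMap : (Vertex → Vertex) → Set
  HomMap f = ∀ {x y} → Near G x y → Near G (f x) (f y)

  cylinder-hom : ∀ {m} f₀ f₁ → HomMap f₀ → HomMap f₁ → (∀ x → Near G (f₀ x) (f₁ x)) →
                 (σ : RawCube G m) → IsHom G σ → IsHom G (cylinder f₀ f₁ σ)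
  cylinder-hom f₀ f₁ f₀-hom f₁-hom f₀~f₁ σ σ-hom (true  ∷ u) _ (zero  , ≡.refl) = near-sym G (f₀~f₁ (σ u))
  cylinder-hom f₀ f₁ f₀-hom f₁-hom f₀~f₁ σ σ-hom (false ∷ u) _ (zero  , ≡.refl) = f₀~f₁ (σ u)
  cylinder-hom f₀ f₁ f₀-hom f₁-hom f₀~f₁ σ σ-hom (true  ∷ u) _ (suc j , ≡.refl) = f₁-hom (σ-hom u _ (j , ≡.refl))
  cylinder-hom f₀ f₁ f₀-hom f₁-hom f₀~f₁ σ σ-hom (false ∷ u) _ (suc j , ≡.refl) = f₀-hom (σ-hom u _ (j , ≡.refl))

  retraction-homMap : HomMap g
  retraction-homMap (inj₁ x≡y) = inj₁ (≡.cong g x≡y)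
  retraction-homMap (inj₂ x~y) = retraction-hom x~y

  id≃retraction : ∀ {m} (σ : RawCube G m) → IsHom G σ → IsHom G (cylinder id g σ)
  id≃retraction = cylinder-hom id g id retraction-homMap near-retraction

  retraction≃centre : ∀ {m} (σ : RawCube G m) → IsHom G σ → IsHom G (cylinder g (const a) σ)
  retraction≃centre = cylinder-hom g (const a) retraction-homMap (λ _ → inj₁ ≡.refl) retraction-near-centre

  δ : ∀ {m} → (RawCube G m → Carrier) → RawCube G (suc m) → Carrier
  δ φ σ = eval φ (∂cube R G σ)

  faceTerm : ∀ {m} → (RawCube G m → Carrier) → RawCube G (suc m) → Fin (suc m) → Carrier
  faceTerm φ σ i = sign R (suc (toℕ i)) * φ (face G i false σ) + (- sign R (suc (toℕ i)) * φ (face G i true σ) + 0#)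

  δ-sum : ∀ {m} (φ : RawCube G m → Carrier) (σ : RawCube G (suc m)) → δ φ σ ≈ sum (faceTerm φ σ)
  δ-sum {m} φ σ = eval-concatMap-tabulate (suc m)
    (λ i → (sign R (suc (toℕ i)) , face G i false σ) ∷ (- sign R (suc (toℕ i)) , face G i true σ) ∷ []) id φ

  δ-cong : ∀ {m} {φ ψ : RawCube G m → Carrier} → (∀ ρ → φ ρ ≈ ψ ρ) → ∀ σ → δ φ σ ≈ δ ψ σ
  δ-cong φ≈ψ σ = eval-cong φ≈ψ (∂cube R G σ)

  δ-cylinder : ∀ {m} f₀ f₁ (φ : RawCube G (suc m) → Carrier) → φ Preserves _≗_ ⟶ _≈_ → (σ : RawCube G (suc m)) →
               δ φ (cylinder f₀ f₁ σ) ≈ (- φ (f₀ ∘ σ) + φ (f₁ ∘ σ)) - δ (φ ∘ cylinder f₀ f₁) σ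
  δ-cylinder {m} f₀ f₁ φ φ-resp σ = begin
    δ φ (cylinder f₀ f₁ σ)                                                ≈⟨ δ-sum φ (cylinder f₀ f₁ σ) ⟩
    faceTerm φ (cylinder f₀ f₁ σ) zero + sum (faceTerm φ (cylinder f₀ f₁ σ) ∘ suc)
      ≈⟨ +-cong first-face (trans (sum-cong-≋ later-face) (sum-neg (suc m) (faceTerm φ′ σ))) ⟩
    (- φ (f₀ ∘ σ) + φ (f₁ ∘ σ)) - sum (faceTerm φ′ σ)                    ≈⟨ +-congˡ (-‿cong (δ-sum φ′ σ)) ⟨
    (- φ (f₀ ∘ σ) + φ (f₁ ∘ σ)) - δ φ′ σ                                  ∎
    where
    φ′ = φ ∘ cylinder f₀ f₁
    first-face : faceTerm φ (cylinder f₀ f₁ σ) zero ≈ - φ (f₀ ∘ σ) + φ (f₁ ∘ σ)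
    first-face = +-cong (-1*x≈-x _) (trans (+-identityʳ _) (trans (*-congʳ (-‿involutive 1#)) (*-identityˡ _)))
    later-face : ∀ j → faceTerm φ (cylinder f₀ f₁ σ) (suc j) ≈ - faceTerm φ′ σ j
    later-face j = begin
      faceTerm φ (cylinder f₀ f₁ σ) (suc j)
        ≈⟨ +-cong (*-cong s′≈-s (φ-resp (face-cylinder f₀ f₁ σ j false)))
                  (+-congʳ (*-cong (-‿cong s′≈-s) (φ-resp (face-cylinder f₀ f₁ σ j true)))) ⟩
      (- s) * X + ((- (- s)) * Y + 0#)
        ≈⟨ solve 3 (λ s X Y → (:- s) :* X :+ ((:- (:- s)) :* Y :+ con (+ 0)) := :- (s :* X :+ ((:- s) :* Y :+ con (+ 0))))
                   refl s X Y ⟩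
      - faceTerm φ′ σ j ∎
      where
      s = sign R (suc (toℕ j))
      X = φ′ (face G j false σ)
      Y = φ′ (face G j true σ)
      s′≈-s : sign R (suc (suc (toℕ j))) ≈ - s
      s′≈-s = sym (trans (-‿cong (sign-suc (toℕ j))) (-‿involutive _))

  nullHomotopy : ∀ {m} → RawCube G m → CChain R G (suc m)
  nullHomotopy σ = (- 1# , cylinder id g σ) ∷ (- 1# , cylinder g (const a) σ) ∷ []

  eval-nullHomotopy : ∀ {m} (φ : RawCube G (suc m) → Carrier) (σ : RawCube G m) →
                      eval φ (nullHomotopy σ) ≈ - (φ (cylinder id g σ) + φ (cylinder g (const a) σ))
  eval-nullHomotopy φ σ = trans (+-cong (-1*x≈-x _) (trans (+-identityʳ _) (-1*x≈-x _))) (-‿+-comm _ _)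

  nullHomotopy-homotopy : ∀ {m} (φ : RawCube G (suc m) → Carrier) → φ Preserves _≗_ ⟶ _≈_ → (σ : RawCube G (suc m)) →
                          eval (δ φ) (nullHomotopy σ) + δ (eval φ ∘ nullHomotopy) σ ≈ φ σ - φ (const a ∘ σ)
  nullHomotopy-homotopy φ φ-resp σ = begin
    eval (δ φ) (nullHomotopy σ) + δ (eval φ ∘ nullHomotopy) σ
      ≈⟨ +-cong (trans (eval-nullHomotopy (δ φ) σ) (-‿cong (+-cong (δ-cylinder id g φ φ-resp σ)
                                                                   (δ-cylinder g (const a) φ φ-resp σ))))
                (trans (δ-cong (eval-nullHomotopy φ) σ)
                       (trans (eval-neg _ (∂cube R G σ)) (-‿cong (eval-+ φ₁ φ₂ (∂cube R G σ))))) ⟩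
    - (((- p + q) - u) + ((- q + r) - v)) + - (u + v)
      ≈⟨ solve 5 (λ p q r u v → :- ((((:- p) :+ q) :- u) :+ (((:- q) :+ r) :- v)) :+ (:- (u :+ v)) := p :- r)
                 refl p q r u v ⟩
    p - r ∎
    where
    φ₁ = φ ∘ cylinder id g
    φ₂ = φ ∘ cylinder g (const a)
    p = φ σ
    q = φ (g ∘ σ)
    r = φ (const a ∘ σ)
    u = δ φ₁ σ
    v = δ φ₂ σ

  module CubeAnnihilation {m} = Annihilation {B = RawCube G m} ≗-isEquivalence (cubeEqB G) cubeEq-sound cubeEq-complete
  open CubeAnnihilation using (eval≈0-if-disjoint; eval-indicator≈0-or)

  valid⇒All : ∀ {m} (x : CChain R G m) → ValidCChain R G x → All (IsHom G ∘ proj₂) x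
  valid⇒All []      _               = []
  valid⇒All (_ ∷ x) (σ-hom , x-valid) = σ-hom ∷ valid⇒All x x-valid

  All⇒valid : ∀ {m} (x : CChain R G m) → All (IsHom G ∘ proj₂) x → ValidCChain R G x
  All⇒valid []      []               = _
  All⇒valid (_ ∷ x) (σ-hom ∷ x-homs) = σ-hom , All⇒valid x x-homs

  ∂cube-hom : ∀ {m} {σ : RawCube G (suc m)} → IsHom G σ → All (IsHom G ∘ proj₂) (∂cube R G σ)
  ∂cube-hom {m} {σ} σ-hom =
    AllP.concat⁺ (AllP.map⁺ {f = faces} (AllP.tabulate⁺ {f = id}
      (λ i → face-hom σ i false σ-hom ∷ face-hom σ i true σ-hom ∷ [])))
    where
    faces : Fin (suc m) → CChain R G m
    faces i = (sign R (suc (toℕ i)) , face G i false σ) ∷ (- sign R (suc (toℕ i)) , face G i true σ) ∷ []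

  nullHomotopy-hom : ∀ {m} {σ : RawCube G m} → IsHom G σ → All (IsHom G ∘ proj₂) (nullHomotopy σ)
  nullHomotopy-hom {σ = σ} σ-hom = id≃retraction σ σ-hom ∷ retraction≃centre σ σ-hom ∷ []

  nullHomotopy-degenerate : ∀ {m} {σ : RawCube G m} → Degenerate G σ → All (Degenerate G ∘ proj₂) (nullHomotopy σ)
  nullHomotopy-degenerate {σ = σ} σ-deg =
    cylinder-degenerate id g σ σ-deg ∷ cylinder-degenerate g (const a) σ σ-deg ∷ []

  χ : ∀ {m} → RawCube G m → RawCube G m → Carrier
  χ = indicator (cubeEqB G)

  χ-resp : ∀ {m} (τ : RawCube G m) → χ τ Preserves _≗_ ⟶ _≈_
  χ-resp τ {σ} {σ′} σ≗σ′ with cubeEqB G σ τ in σ~τ | cubeEqB G σ′ τ in σ′~τ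
  ... | true  | true  = refl
  ... | false | false = refl
  ... | true  | false =
    case ≡.trans (≡.sym σ′~τ) (cubeEq-complete (λ v → ≡.trans (≡.sym (σ≗σ′ v)) (cubeEq-sound σ~τ v))) of λ ()
  ... | false | true  =
    case ≡.trans (≡.sym σ~τ) (cubeEq-complete (λ v → ≡.trans (σ≗σ′ v) (cubeEq-sound σ′~τ v))) of λ ()

  χ∘s : ∀ {m} → RawCube G (suc m) → RawCube G m → Carrier
  χ∘s τ = eval (χ τ) ∘ nullHomotopy

  χ∘s-resp : ∀ {m} (τ : RawCube G (suc m)) → χ∘s τ Preserves _≗_ ⟶ _≈_
  χ∘s-resp τ ρ≗ρ′ = +-cong (*-congˡ (χ-resp τ (cylinder-resp id g ρ≗ρ′)))
                           (+-congʳ (*-congˡ (χ-resp τ (cylinder-resp g (const a) ρ≗ρ′))))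

  χ-constant≈0 : ∀ {m} {τ : RawCube G (suc m)} → ¬ Degenerate G τ → ∀ σ → χ τ (const a ∘ σ) ≈ 0#
  χ-constant≈0 {τ = τ} τ-nondeg σ with cubeEqB G (const a ∘ σ) τ in c∘σ~τ
  ... | false = refl
  ... | true  = ⊥-elim (τ-nondeg (degenerate-resp (cubeEq-sound c∘σ~τ) (constant-degenerate σ)))

  coeff-∂s : ∀ {m} (x : CChain R G (suc m)) τ →
             coeffC R G (∂C R G (linExt R nullHomotopy x)) τ ≈
             (coeffC R G x τ - eval (χ τ ∘ (const a ∘_)) x) - eval (χ∘s τ) (∂C R G x)
  coeff-∂s x τ = begin
    coeffC R G (∂C R G sx) τ                                 ≈⟨ coeffWith≈eval-indicator (cubeEqB G) (∂C R G sx) τ ⟩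
    eval (χ τ) (∂C R G sx)                                   ≈⟨ eval-linExt (∂cube R G) (χ τ) sx ⟩
    eval (δ (χ τ)) sx                                        ≈⟨ eval-linExt nullHomotopy (δ (χ τ)) x ⟩
    eval (eval (δ (χ τ)) ∘ nullHomotopy) x                   ≈⟨ eval-cong ∂s≈id-c-s∂ x ⟩
    eval (λ σ → (χ τ σ - χ τ (const a ∘ σ)) - δ (χ∘s τ) σ) x ≈⟨ eval-sub (λ σ → χ τ σ - χ τ (const a ∘ σ)) (δ (χ∘s τ)) x ⟩
    eval (λ σ → χ τ σ - χ τ (const a ∘ σ)) x - eval (δ (χ∘s τ)) x
      ≈⟨ +-cong (trans (eval-sub (χ τ) (χ τ ∘ (const a ∘_)) x)
                       (+-congʳ (sym (coeffWith≈eval-indicator (cubeEqB G) x τ))))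
                (-‿cong (sym (eval-linExt (∂cube R G) (χ∘s τ) x))) ⟩
    (coeffC R G x τ - eval (χ τ ∘ (const a ∘_)) x) - eval (χ∘s τ) (∂C R G x) ∎
    where
    sx = linExt R nullHomotopy x
    ∂s≈id-c-s∂ : ∀ σ → eval (δ (χ τ)) (nullHomotopy σ) ≈ (χ τ σ - χ τ (const a ∘ σ)) - δ (χ∘s τ) σ
    ∂s≈id-c-s∂ σ = trans (sym (//-rightDividesʳ (δ (χ∘s τ) σ) _)) (+-congʳ (nullHomotopy-homotopy (χ τ) (χ-resp τ) σ))

  χ∘s-cycle≈0 : ∀ {m} (x : CChain R G (suc m)) → ValidCChain R G x → EqC R G (∂C R G x) [] →
                ∀ τ → ¬ Degenerate G τ → eval (χ∘s τ) (∂C R G x) ≈ 0#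
  χ∘s-cycle≈0 x x-valid x-cycle τ τ-nondeg = eval≈0-if-disjoint (χ∘s τ) (χ∘s-resp τ) (∂C R G x) disjoint
    where
    ∂x-hom : All (IsHom G ∘ proj₂) (∂C R G x)
    ∂x-hom = All-linExt (∂cube R G) ∂cube-hom x (valid⇒All x x-valid)
    disjoint : ∀ ρ → eval (χ ρ) (∂C R G x) ≈ 0# ⊎ χ∘s τ ρ ≈ 0#
    disjoint ρ with eval-indicator≈0-or degenerate-resp τ (nullHomotopy ρ) nullHomotopy-degenerate
                  | eval-indicator≈0-or isHom-resp ρ (∂C R G x) (λ (_ : ⊤) → ∂x-hom)
    ... | inj₁ χ∘s≈0           | _            = inj₂ χ∘s≈0
    ... | inj₂ _               | inj₁ coeff≈0 = inj₁ coeff≈0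
    ... | inj₂ deg[ρ]⇒deg[τ]   | inj₂ ρ-hom   = inj₁ (trans (sym (coeffWith≈eval-indicator (cubeEqB G) (∂C R G x) ρ))
                                                              (x-cycle ρ (ρ-hom tt) (τ-nondeg ∘ deg[ρ]⇒deg[τ])))

  cubicalHomologyVanishes : ∀ n → CubeHomologyVanishes R G (suc n)
  cubicalHomologyVanishes n x x-valid x-cycle = y , All⇒valid y y-hom , ∂y≈x
    where
    y : CChain R G (suc (suc n))
    y = linExt R nullHomotopy x

    y-hom : All (IsHom G ∘ proj₂) y
    y-hom = All-linExt nullHomotopy nullHomotopy-hom x (valid⇒All x x-valid)

    ∂y≈x : EqC R G (∂C R G y) x
    ∂y≈x τ _ τ-nondeg = begin
      coeffC R G (∂C R G y) τ                                                   ≈⟨ coeff-∂s x τ ⟩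
      (coeffC R G x τ - eval (χ τ ∘ (const a ∘_)) x) - eval (χ∘s τ) (∂C R G x)
        ≈⟨ +-cong (+-congˡ (-‿cong (eval-zero (χ-constant≈0 τ-nondeg) x)))
                  (-‿cong (χ∘s-cycle≈0 x x-valid x-cycle τ τ-nondeg)) ⟩
      (coeffC R G x τ - 0#) - 0#                                                ≈⟨ trans (x-0#≈x _) (x-0#≈x _) ⟩
      coeffC R G x τ                                                            ∎

joinContraction : (K₁ K₂ : Graph) → Fin (size K₁) → Fin (size K₂) → TwoStepContraction (K₁ *ᴳ K₂)
joinContraction K₁ K₂ a₁ b₂ = record
  { centre                 = a
  ; retraction             = g
  ; retraction-hom         = λ {x} {y} → opposite-hom (splitAt s₁ x) (splitAt s₁ y)
  ; near-retraction        = λ x → inj₂ (adjacent-opposite (splitAt s₁ x))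
  ; retraction-near-centre = λ x → opposite-near-a (splitAt s₁ x)
  }
  where
  G = K₁ *ᴳ K₂
  s₁ = size K₁
  s₂ = size K₂

  a b : Fin (size G)
  a = a₁ ↑ˡ s₂
  b = s₁ ↑ʳ b₂

  split-a : splitAt s₁ a ≡ inj₁ a₁
  split-a = Fin.splitAt-↑ˡ s₁ a₁ s₂

  split-b : splitAt s₁ {s₂} b ≡ inj₂ b₂
  split-b = Fin.splitAt-↑ʳ s₁ s₂ b₂

  opposite : Fin s₁ ⊎ Fin s₂ → Fin (size G)
  opposite (inj₁ _) = b
  opposite (inj₂ _) = a

  g : Fin (size G) → Fin (size G)
  g = opposite ∘ splitAt s₁

  adjacent-opposite : ∀ p → JoinAdj' K₁ K₂ p (splitAt s₁ (opposite p))
  adjacent-opposite (inj₁ _) rewrite split-b = tt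
  adjacent-opposite (inj₂ _) rewrite split-a = tt

  a~b : Adj G a b
  a~b rewrite split-a | split-b = tt

  opposite-hom : ∀ p q → JoinAdj' K₁ K₂ p q → Near G (opposite p) (opposite q)
  opposite-hom (inj₁ _) (inj₁ _) _ = inj₁ ≡.refl
  opposite-hom (inj₂ _) (inj₂ _) _ = inj₁ ≡.refl
  opposite-hom (inj₁ _) (inj₂ _) _ = inj₂ (Graph.sym G a~b)
  opposite-hom (inj₂ _) (inj₁ _) _ = inj₂ a~b

  opposite-near-a : ∀ p → Near G (opposite p) a
  opposite-near-a (inj₁ _) = inj₂ (Graph.sym G a~b)
  opposite-near-a (inj₂ _) = inj₁ ≡.refl

corollary4p6 : {c ℓ : Level} (R : CommutativeRing c ℓ) (K₁ K₂ : Graph) →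
    NonEmptyGraph K₁ → NonEmptyGraph K₂ → (n : ℕ) →
    PathHomologyVanishes R (K₁ *ᴳ K₂) (suc n) × CubeHomologyVanishes R (K₁ *ᴳ K₂) (suc n)
corollary4p6 R K₁ K₂ K₁-nonempty K₂-nonempty n =
  PathHomologyOfContraction.pathHomologyVanishes join-contraction R n ,
  CubicalHomologyOfContraction.cubicalHomologyVanishes join-contraction R n
  where
  join-contraction = joinContraction K₁ K₂ (Fin.fromℕ< K₁-nonempty) (Fin.fromℕ< K₂-nonempty)
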